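{- Let $f:2^{\mathcal U}\to\mathbb{R}_{\ge0}$ be submodular, $k,\ell$ positive integers, $m=\lfloor k/\ell\rfloor$, and $O\subseteq\mathcal U$ any set (in the paper, an optimal set of size at most $k$). Consider the following randomized algorithm. Add $2k$ dummy elements $D$ to the ground set with $f(S)=f(S\setminus D)$; set $G_0\leftarrow\emptyset$ and a candidate pool $V\leftarrow\mathcal U\cup D$. For $i=1,\dots,\ell$: set $A_l\leftarrow G_{i-1}$ for all $l\in[\ell]$; for $j=1,\dots,m$ and, within that, for $l=1,\dots,\ell$ in order: choose $a\in\arg\max_{x\in V}\Delta(x\mid A_l)$, set $A_l\leftarrow A_l\cup\{a\}$ and $V\leftarrow V\setminus\{a\}$; then let $G_i$ be one of $A_1,\dots,A_\ell$ chosen uniformly at random. Then for every $i\in\{1,\dots,\ell\}$, $$\mathbb{E}[f(O\cup G_i)]\ge\Big(1-\frac1\ell\Big)\mathbb{E}[f(O\cup G_{i-1})].$$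
   Context: A set function $f$ is submodular if $f(X)+f(Y)\ge f(X\cup Y)+f(X\cap Y)$ for all $X,Y$; $f$ is nonnegative and not assumed monotone. $\Delta(x\mid Y)=f(Y\cup\{x\})-f(Y)$. Expectations are over the algorithm's random choices. -}

module Defs where

open import Level using (Level; suc; _⊔_)
open import Data.Nat as ℕ using (ℕ; zero; NonZero)
open import Data.Nat.DivMod using (_/_)
open import Data.Bool using (false)
open import Data.Maybe using (Maybe; just; nothing)
open import Data.Product using (_×_; _,_; proj₁; proj₂)
open import Data.Fin using (Fin)
open import Data.Fin.Subset using (Subset; _∪_; _∩_; ⁅_⁆; _∈_; _∉_; ⊥; _-_)
open import Data.Vec using (Vec; []; _∷_; take; replicate; lookup; foldr; _++_; tabulate)
open import Relation.Binary.PropositionalEquality using (_≡_)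
open import Relation.Binary.Structures using (IsTotalOrder)
open import Relation.Nullary using (¬_)
open import Algebra.Structures using (IsCommutativeRing)

-- Ordered fields (the stdlib has no reals; ℝ is an instance of this).

record OrderedField (c ℓ : Level) : Set (Level.suc (c ⊔ ℓ)) where
  infixl 6 _+F_ _-F_
  infixl 7 _*F_
  infix 4 _≤F_
  field
    Carrier : Set c
    _+F_ _*F_ : Carrier → Carrier → Carrier
    -F_ : Carrier → Carrier
    0F 1F : Carrier
    _⁻¹ : Carrier → Carrier
    _≤F_ : Carrier → Carrier → Set ℓ
    isCommutativeRing : IsCommutativeRing _≡_ _+F_ _*F_ -F_ 0F 1F
    isTotalOrder : IsTotalOrder _≡_ _≤F_
    0≢1 : ¬ (0F ≡ 1F)
    ⁻¹-inverse : ∀ x → ¬ (x ≡ 0F) → x *F (x ⁻¹) ≡ 1F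
    +-mono-≤ : ∀ {x y} z → x ≤F y → x +F z ≤F y +F z
    *-nonneg : ∀ {x y} → 0F ≤F x → 0F ≤F y → 0F ≤F x *F y

  _-F_ : Carrier → Carrier → Carrier
  x -F y = x +F (-F y)

  fromℕ : ℕ → Carrier
  fromℕ zero = 0F
  fromℕ (ℕ.suc n) = 1F +F fromℕ n

  sumV : ∀ {r} → Vec Carrier r → Carrier
  sumV = foldr _ _+F_ 0F

module _ {c ℓ} (F : OrderedField c ℓ) where
  open OrderedField F

  Submodular : ∀ {n} → (Subset n → Carrier) → Set ℓ
  Submodular f = ∀ X Y → f (X ∪ Y) +F f (X ∩ Y) ≤F f X +F f Y

  Nonnegative : ∀ {n} → (Subset n → Carrier) → Set ℓ
  Nonnegative f = ∀ X → 0F ≤F f X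

-- The algorithm.  The extended ground set 𝒰 ∪ D is Fin (n + 2k); indices
-- < n are the original elements, the last 2k are the dummies D.

module Algorithm {c ℓ'} (F : OrderedField c ℓ') {n : ℕ} (f : Subset n → OrderedField.Carrier F)
                 (k ℓ : ℕ) .{{_ : NonZero ℓ}} where
  open OrderedField F

  N : ℕ
  N = n ℕ.+ (2 ℕ.* k)

  m : ℕ
  m = k / ℓ

  -- f on the extended ground set: f(S) = f(S \ D)
  fExt : Subset N → Carrier
  fExt S = f (take n S)

  lift : Subset n → Subset N
  lift O = O ++ replicate (2 ℕ.* k) false

  Δ : Fin N → Subset N → Carrier
  Δ x Y = fExt (Y ∪ ⁅ x ⁆) -F fExt Y

  -- A tie-breaking rule for "choose a ∈ argmax_{x ∈ V} Δ(x | A)".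
  -- Arguments: outer index i, index j, index l, pool V, current set A_l.
  -- It returns nothing only when V is empty.
  Selector : Set
  Selector = ℕ → ℕ → ℕ → Subset N → Subset N → Maybe (Fin N)

  IsArgmaxSelector : Selector → Set ℓ'
  IsArgmaxSelector sel = ∀ i j l V A →
      (∀ a → sel i j l V A ≡ just a → a ∈ V × (∀ y → y ∈ V → Δ y A ≤F Δ a A))
    × (sel i j l V A ≡ nothing → ∀ y → y ∉ V)

  module Run (sel : Selector) where

    addPick : Maybe (Fin N) → Subset N → Subset N → Subset N × Subset N
    addPick (just a) V A = (V - a) , (A ∪ ⁅ a ⁆)
    addPick nothing  V A = V , A

    -- one pass l = o, o+1, … over the sets A_l (in order), for fixed i, j
    passL : ∀ {r} → ℕ → ℕ → ℕ → Subset N → Vec (Subset N) r → Subset N × Vec (Subset N) r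
    passL i j o V [] = V , []
    passL i j o V (A ∷ As) =
      let VA  = addPick (sel i j o V A) V A
          VAs = passL i j (ℕ.suc o) (proj₁ VA) As
      in proj₁ VAs , (proj₂ VA ∷ proj₂ VAs)

    -- the loop over j = j₀, …, j₀ + r - 1 (each doing the pass over l = 1..ℓ)
    loopJ : ℕ → ℕ → ℕ → Subset N → Vec (Subset N) ℓ → Subset N × Vec (Subset N) ℓ
    loopJ i j zero V As = V , As
    loopJ i j (ℕ.suc r) V As =
      let VAs = passL i j 1 V As in loopJ i (ℕ.suc j) r (proj₁ VAs) (proj₂ VAs)

    -- State of the algorithm between outer iterations: (G , V)
    State : Set
    State = Subset N × Subset N

    initial : State
    initial = ⊥ , Data.Fin.Subset.⊤

    -- outer iteration i from state (G_{i-1}, V): the ℓ equally likely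
    -- successor states (G_i = A_l, V)
    round : ℕ → State → Vec State ℓ
    round i (G , V) =
      let VAs = loopJ i 1 m V (replicate ℓ G)
      in tabulate (λ l → lookup (proj₂ VAs) l , proj₁ VAs)

    -- expect d i s: expected value of g(G) after running d further outer
    -- iterations i, i+1, … from state s (uniform choice among ℓ each time)
    expect : (Subset N → Carrier) → ℕ → ℕ → State → Carrier
    expect g zero i (G , V) = g G
    expect g (ℕ.suc d) i s =
      (fromℕ ℓ ⁻¹) *F sumV (Data.Vec.map (expect g d (ℕ.suc i)) (round i s))

    E-fOG : Subset n → ℕ → Carrier
    E-fOG O i = expect (λ G → fExt (lift O ∪ G)) i 1 initial

{-# OPTIONS --safe #-}
module Submission where

-- Every element added to a set A_l is
-- taken out of the pool V, and the pool meets the sets only inside G; so A_1 … A_ℓ form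
-- a sunflower with kernel G: each contains G, and any two of them meet exactly in G.
-- Adding the petals one at a time, submodularity of g X = f (O ∪ X) gives
-- ℓ g(G) + g(A_1 ∪ … ∪ A_ℓ) ≤ Σ g(A_l) + g(G), so by nonnegativity the uniform average of
-- the g(A_l) is at least (1 - 1/ℓ) g(G).  Averaging this one-round bound over the earlier
-- random choices gives the theorem.

open import Algebra.Bundles using (CommutativeRing)
open import Data.Bool using (_∨_; _∧_)
open import Data.Empty using (⊥-elim)
open import Data.Fin using (zero; suc)
open import Data.Fin.Subset using (Subset; _∪_; _∩_; _⊆_; _∈_; _∉_; _-_; ⁅_⁆)
open import Data.Fin.Subset.Properties
  using (⊆-antisym; p∩q⊆p; p⊆p∪q; q⊆p∪q; x∈p∩q⁺; x∈p∩q⁻; x∈p∪q⁻; x∈⁅y⁆⇒x≡y; p─q⊆p;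
         ∪-idem; ∪-distribˡ-∩; ∪-idempotentCommutativeMonoid)
open import Data.Maybe using (just; nothing)
open import Data.Nat using (ℕ; zero; suc; _+_; NonZero; _≤_; _∸_)
open import Data.Product using (_×_; _,_; proj₁; proj₂)
open import Data.Sum using (_⊎_; inj₁; inj₂; [_,_]′)
import Data.Sum as Sum
open import Data.Vec using (Vec; []; _∷_; there; map; foldr; replicate; take; tabulate; lookup)
open import Data.Vec.Properties using (take-zipWith; tabulate-∘; tabulate∘lookup; map-∘)
open import Function using (id; _∘_)
open import Relation.Binary.Bundles using (Poset)
open import Relation.Binary.PropositionalEquality
  using (_≡_; _≢_; refl; sym; trans; cong; subst; subst₂; module ≡-Reasoning)
import Relation.Binary.Reasoning.PartialOrder as ≤-Reasoning
open import Relation.Binary.Structures using (IsTotalOrder)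
open import Relation.Nullary using (¬_)

open import Defs

module OrderedFieldProperties {c ℓ} (F : OrderedField c ℓ) where

  open OrderedField F renaming (+-mono-≤ to +-monoˡ-≤)

  commutativeRing : CommutativeRing c c
  commutativeRing = record { isCommutativeRing = isCommutativeRing }

  open CommutativeRing commutativeRing using (ring; commutativeSemiring; *-commutativeSemigroup)
  open CommutativeRing commutativeRing public
    using (+-comm; +-assoc; +-identityˡ; +-identityʳ; -‿inverseˡ; -‿inverseʳ;
           *-comm; *-assoc; *-identityʳ; distribˡ; zeroʳ)
  open import Algebra.Properties.Ring ring using (-‿distribˡ-*; -‿distribʳ-*; -‿involutive)
  open import Algebra.Properties.CommutativeSemigroup *-commutativeSemigroup public using (x∙yz≈y∙xz)
  open import Algebra.Solver.Ring.NaturalCoefficients.Default commutativeSemiring public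
  open IsTotalOrder isTotalOrder using (total; antisym) renaming (refl to ≤-refl; trans to ≤-trans)

  poset : Poset c c ℓ
  poset = record { isPartialOrder = IsTotalOrder.isPartialOrder isTotalOrder }

  +-monoʳ-≤ : ∀ z {x y} → x ≤F y → z +F x ≤F z +F y
  +-monoʳ-≤ z {x} {y} x≤y = subst₂ _≤F_ (+-comm x z) (+-comm y z) (+-monoˡ-≤ z x≤y)

  +-mono-≤ : ∀ {x y u v} → x ≤F y → u ≤F v → x +F u ≤F y +F v
  +-mono-≤ {y = y} {u} x≤y u≤v = ≤-trans (+-monoˡ-≤ u x≤y) (+-monoʳ-≤ y u≤v)

  x+y-y≡x : ∀ x y → x +F y -F y ≡ x
  x+y-y≡x x y = begin
    x +F y -F y        ≡⟨ +-assoc x y (-F y) ⟩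
    x +F (y -F y)      ≡⟨ cong (x +F_) (-‿inverseʳ y) ⟩
    x +F 0F            ≡⟨ +-identityʳ x ⟩
    x                  ∎
    where open ≡-Reasoning

  +-cancelʳ-≤ : ∀ z {x y} → x +F z ≤F y +F z → x ≤F y
  +-cancelʳ-≤ z {x} {y} le = subst₂ _≤F_ (x+y-y≡x x z) (x+y-y≡x y z) (+-monoˡ-≤ (-F z) le)

  x≤y⇒0≤y-x : ∀ {x y} → x ≤F y → 0F ≤F y -F x
  x≤y⇒0≤y-x {x} x≤y = subst (_≤F _) (-‿inverseʳ x) (+-monoˡ-≤ (-F x) x≤y)

  x≤0⇒0≤-x : ∀ {x} → x ≤F 0F → 0F ≤F -F x
  x≤0⇒0≤-x {x} x≤0 = subst (0F ≤F_) (+-identityˡ (-F x)) (x≤y⇒0≤y-x x≤0)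

  -x*-x≡x*x : ∀ x → (-F x) *F (-F x) ≡ x *F x
  -x*-x≡x*x x = begin
    (-F x) *F (-F x)     ≡⟨ -‿distribʳ-* (-F x) x ⟨
    -F ((-F x) *F x)     ≡⟨ cong -F_ (-‿distribˡ-* x x) ⟨
    -F (-F (x *F x))     ≡⟨ -‿involutive (x *F x) ⟩
    x *F x               ∎
    where open ≡-Reasoning

  0≤x*x : ∀ x → 0F ≤F x *F x
  0≤x*x x with total 0F x
  ... | inj₁ 0≤x = *-nonneg 0≤x 0≤x
  ... | inj₂ x≤0 = subst (0F ≤F_) (-x*-x≡x*x x) (*-nonneg (x≤0⇒0≤-x x≤0) (x≤0⇒0≤-x x≤0))

  0≤1 : 0F ≤F 1F
  0≤1 = subst (0F ≤F_) (*-identityʳ 1F) (0≤x*x 1F)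

  1≰0 : ¬ (1F ≤F 0F)
  1≰0 1≤0 = 0≢1 (antisym 0≤1 1≤0)

  0≤fromℕ : ∀ r → 0F ≤F fromℕ r
  0≤fromℕ zero    = ≤-refl
  0≤fromℕ (suc r) = subst (_≤F fromℕ (suc r)) (+-identityˡ 0F) (+-mono-≤ 0≤1 (0≤fromℕ r))

  fromℕ-suc≢0 : ∀ r → fromℕ (suc r) ≢ 0F
  fromℕ-suc≢0 r eq = 1≰0 (subst₂ _≤F_ (+-identityʳ 1F) eq (+-monoʳ-≤ 1F (0≤fromℕ r)))

  0≤x⇒0≤x⁻¹ : ∀ {x} → 0F ≤F x → x ≢ 0F → 0F ≤F x ⁻¹
  0≤x⇒0≤x⁻¹ {x} 0≤x x≢0 with total 0F (x ⁻¹)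
  ... | inj₁ 0≤x⁻¹ = 0≤x⁻¹
  ... | inj₂ x⁻¹≤0 = ⊥-elim (1≰0 (subst₂ _≤F_ (+-identityˡ 1F) (-‿inverseˡ 1F) (+-monoˡ-≤ 1F 0≤-1)))
    where
      0≤-1 : 0F ≤F -F 1F
      0≤-1 = subst (0F ≤F_) (trans (sym (-‿distribʳ-* x (x ⁻¹))) (cong -F_ (⁻¹-inverse x x≢0)))
                   (*-nonneg 0≤x (x≤0⇒0≤-x x⁻¹≤0))

  *-monoʳ-≤ : ∀ {z x y} → 0F ≤F z → x ≤F y → z *F x ≤F z *F y
  *-monoʳ-≤ {z} {x} {y} 0≤z x≤y =
    subst₂ _≤F_ (+-identityʳ (z *F x)) z*x+z*[y-x]≡z*y (+-monoʳ-≤ (z *F x) (*-nonneg 0≤z (x≤y⇒0≤y-x x≤y)))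
    where
      z*x+z*[y-x]≡z*y : z *F x +F z *F (y -F x) ≡ z *F y
      z*x+z*[y-x]≡z*y = begin
        z *F x +F z *F (y -F x)   ≡⟨ distribˡ z x (y -F x) ⟨
        z *F (x +F (y -F x))      ≡⟨ cong (z *F_) (+-comm x (y -F x)) ⟩
        z *F (y -F x +F x)        ≡⟨ cong (z *F_) (+-assoc y (-F x) x) ⟩
        z *F (y +F (-F x +F x))   ≡⟨ cong (λ w → z *F (y +F w)) (-‿inverseˡ x) ⟩
        z *F (y +F 0F)            ≡⟨ cong (z *F_) (+-identityʳ y) ⟩
        z *F y                    ∎
        where open ≡-Reasoning

  *-sumV-≤ : ∀ {a} {A : Set a} {r} z {φ ψ : A → Carrier} → (∀ x → z *F φ x ≤F ψ x) →
             (xs : Vec A r) → z *F sumV (map φ xs) ≤F sumV (map ψ xs)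
  *-sumV-≤ z le []       = subst (_≤F 0F) (sym (zeroʳ z)) ≤-refl
  *-sumV-≤ z le (x ∷ xs) = subst (_≤F _) (sym (distribˡ z _ _)) (+-mono-≤ (le x) (*-sumV-≤ z le xs))

  z*[1+p]≡1⇒1-z≡z*p : ∀ {z p} → z *F (1F +F p) ≡ 1F → 1F -F z ≡ z *F p
  z*[1+p]≡1⇒1-z≡z*p {z} {p} z*[1+p]≡1 = begin
    1F -F z                  ≡⟨ cong (_-F z) z*[1+p]≡1 ⟨
    z *F (1F +F p) -F z      ≡⟨ cong (_-F z) (distribˡ z 1F p) ⟩
    z *F 1F +F z *F p -F z   ≡⟨ cong (λ w → w +F z *F p -F z) (*-identityʳ z) ⟩
    z +F z *F p -F z         ≡⟨ cong (_-F z) (+-comm z (z *F p)) ⟩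
    z *F p +F z -F z         ≡⟨ x+y-y≡x (z *F p) z ⟩
    z *F p                   ∎
    where open ≡-Reasoning

module Sunflowers {N : ℕ} where

  infixr 6 _∪⋃_

  _∪⋃_ : ∀ {r} → Subset N → Vec (Subset N) r → Subset N
  G ∪⋃ As = foldr (λ _ → Subset N) _∪_ G As

  ⊆-∪⋃ : ∀ {r} G (As : Vec (Subset N) r) → G ⊆ G ∪⋃ As
  ⊆-∪⋃ G []       = id
  ⊆-∪⋃ G (A ∷ As) = q⊆p∪q A _ ∘ ⊆-∪⋃ G As

  ∪⋃-replicate : ∀ r G → G ∪⋃ replicate r G ≡ G
  ∪⋃-replicate zero    G = refl
  ∪⋃-replicate (suc r) G = trans (cong (G ∪_) (∪⋃-replicate r G)) (∪-idem G)

  data Sunflower (G : Subset N) : ∀ {r} → Vec (Subset N) r → Set where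
    []    : Sunflower G []
    petal : ∀ {r A} {As : Vec (Subset N) r} →
            G ⊆ A → A ∩ (G ∪⋃ As) ⊆ G → Sunflower G As → Sunflower G (A ∷ As)

  replicate-sunflower : ∀ r G → Sunflower G (replicate r G)
  replicate-sunflower zero    G = []
  replicate-sunflower (suc r) G = petal id (p∩q⊆p G _) (replicate-sunflower r G)

module SunflowerBound {c ℓ} (F : OrderedField c ℓ) {N : ℕ} {h : Subset N → OrderedField.Carrier F}
                      (h-submodular : Submodular F h) where
  open OrderedField F
  open OrderedFieldProperties F
  open Sunflowers {N}
  open ≤-Reasoning poset

  sunflower-bound : ∀ {r G} {As : Vec (Subset N) r} → Sunflower G As →
                    fromℕ r *F h G +F h (G ∪⋃ As) ≤F sumV (map h As) +F h G
  sunflower-bound {G = G} [] = begin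
    0F *F h G +F h G   ≡⟨ solve 1 (λ g → con 0 :* g :+ g := con 0 :+ g) refl (h G) ⟩
    0F +F h G          ∎
  sunflower-bound {suc r} {G} (petal {A = A} {As} G⊆A A∩U⊆G flower) = begin
    fromℕ (suc r) *F h G +F h (A ∪ U)     ≡⟨ solve 3 (λ P g t → (con 1 :+ P) :* g :+ t := P :* g :+ (t :+ g))
                                                    refl (fromℕ r) (h G) (h (A ∪ U)) ⟩
    fromℕ r *F h G +F (h (A ∪ U) +F h G)  ≤⟨ +-monoʳ-≤ (fromℕ r *F h G) petal-submodular ⟩
    fromℕ r *F h G +F (h A +F h U)        ≡⟨ solve 3 (λ P a u → P :+ (a :+ u) := a :+ (P :+ u))
                                                    refl (fromℕ r *F h G) (h A) (h U) ⟩
    h A +F (fromℕ r *F h G +F h U)        ≤⟨ +-monoʳ-≤ (h A) (sunflower-bound flower) ⟩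
    h A +F (sumV (map h As) +F h G)       ≡⟨ +-assoc (h A) _ (h G) ⟨
    h A +F sumV (map h As) +F h G         ∎
    where
      U = G ∪⋃ As
      A∩U≡G : A ∩ U ≡ G
      A∩U≡G = ⊆-antisym A∩U⊆G (λ x∈G → x∈p∩q⁺ (G⊆A x∈G , ⊆-∪⋃ G As x∈G))
      petal-submodular : h (A ∪ U) +F h G ≤F h A +F h U
      petal-submodular = subst (λ X → h (A ∪ U) +F h X ≤F h A +F h U) A∩U≡G (h-submodular A U)

  sunflower-sum-bound : Nonnegative F h → ∀ {p G} {As : Vec (Subset N) (suc p)} → Sunflower G As →
                        fromℕ p *F h G ≤F sumV (map h As)
  sunflower-sum-bound h-nonneg {p} {G} {As} flower = +-cancelʳ-≤ (h G) (begin
    fromℕ p *F h G +F h G               ≡⟨ solve 2 (λ P g → P :* g :+ g := (con 1 :+ P) :* g :+ con 0)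
                                                 refl (fromℕ p) (h G) ⟩
    fromℕ (suc p) *F h G +F 0F          ≤⟨ +-monoʳ-≤ _ (h-nonneg (G ∪⋃ As)) ⟩
    fromℕ (suc p) *F h G +F h (G ∪⋃ As) ≤⟨ sunflower-bound flower ⟩
    sumV (map h As) +F h G              ∎)

module SubmodularClosure {c ℓ} (F : OrderedField c ℓ) where
  open OrderedField F

  Submodular-∘-take : ∀ {n m} {f : Subset n → Carrier} → Submodular F f →
                      Submodular F (λ (X : Subset (n + m)) → f (take n X))
  Submodular-∘-take {n} {f = f} f-submodular X Y =
    subst₂ (λ U I → f U +F f I ≤F f (take n X) +F f (take n Y))
           (sym (take-zipWith _∨_ X Y)) (sym (take-zipWith _∧_ X Y))
           (f-submodular (take n X) (take n Y))

  Submodular-∘-∪ˡ : ∀ {N} {h : Subset N → Carrier} → Submodular F h →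
                    ∀ L → Submodular F (λ X → h (L ∪ X))
  Submodular-∘-∪ˡ {N} {h} h-submodular L X Y =
    subst₂ (λ U I → h U +F h I ≤F h (L ∪ X) +F h (L ∪ Y))
           (sym (∙-distrˡ-∙ L X Y)) (sym (∪-distribˡ-∩ L X Y))
           (h-submodular (L ∪ X) (L ∪ Y))
    where open import Algebra.Properties.IdempotentCommutativeMonoid (∪-idempotentCommutativeMonoid N)
                        using (∙-distrˡ-∙)

x∉p-x : ∀ {n} (p : Subset n) x → x ∉ p - x
x∉p-x (_ ∷ p) zero    ()
x∉p-x (_ ∷ p) (suc x) (there x∈p-x) = x∉p-x p x x∈p-x

record Draw {N : ℕ} (V A V′ A′ : Subset N) : Set where
  field
    pool-shrinks     : V′ ⊆ V
    grows            : A ⊆ A′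
    gains-from-pool  : ∀ {x} → x ∈ A′ → x ∈ A ⊎ x ∈ V
    gains-leave-pool : ∀ {x} → x ∈ A′ → x ∈ V′ → x ∈ A

module GreedyRounds {c ℓ'} (F : OrderedField c ℓ') {n : ℕ} (f : Subset n → OrderedField.Carrier F)
                    (k p : ℕ) where
  open OrderedField F
  open OrderedFieldProperties F
  open Algorithm F f k (suc p)
  open Sunflowers {N}

  PicksFromPool : Selector → Set
  PicksFromPool sel = ∀ i j l V A a → sel i j l V A ≡ just a → a ∈ V

  argmax⇒picksFromPool : ∀ {sel} → IsArgmaxSelector sel → PicksFromPool sel
  argmax⇒picksFromPool isArgmax i j l V A a eq = proj₁ (proj₁ (isArgmax i j l V A) a eq)

  SunflowerOffPool : ∀ {r} → Subset N → Subset N → Vec (Subset N) r → Set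
  SunflowerOffPool G V As = Sunflower G As × (G ∪⋃ As) ∩ V ⊆ G

  ι : Carrier
  ι = fromℕ (suc p) ⁻¹

  0≤ι : 0F ≤F ι
  0≤ι = 0≤x⇒0≤x⁻¹ (0≤fromℕ (suc p)) (fromℕ-suc≢0 p)

  [1-ι]x≡ι[px] : ∀ x → (1F -F ι) *F x ≡ ι *F (fromℕ p *F x)
  [1-ι]x≡ι[px] x = trans (cong (_*F x) (z*[1+p]≡1⇒1-z≡z*p ι[1+p]≡1)) (*-assoc ι (fromℕ p) x)
    where
      ι[1+p]≡1 : ι *F fromℕ (suc p) ≡ 1F
      ι[1+p]≡1 = trans (*-comm ι _) (⁻¹-inverse _ (fromℕ-suc≢0 p))

  module _ (sel : Selector) where
    open Run sel

    expect-contracts : ∀ {g z} → (∀ i s → z *F expect g 0 i s ≤F expect g 1 i s) →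
                       ∀ d i s → z *F expect g d i s ≤F expect g (suc d) i s
    expect-contracts base zero    i s = base i s
    expect-contracts {g} {z} base (suc d) i s = begin
      z *F (ι *F S d)  ≡⟨ x∙yz≈y∙xz z ι (S d) ⟩
      ι *F (z *F S d)  ≤⟨ *-monoʳ-≤ 0≤ι (*-sumV-≤ z (expect-contracts base d (suc i)) (round i s)) ⟩
      ι *F S (suc d)   ∎
      where
        open ≤-Reasoning poset
        S : ℕ → Carrier
        S e = sumV (map (expect g e (suc i)) (round i s))

  module _ {sel : Selector} (picks : PicksFromPool sel) where
    open Run sel

    addPick-draw : ∀ {V A} q → (∀ a → q ≡ just a → a ∈ V) →
                   Draw V A (proj₁ (addPick q V A)) (proj₂ (addPick q V A))
    addPick-draw nothing  _ = record
      { pool-shrinks = id ; grows = id ; gains-from-pool = inj₁ ; gains-leave-pool = λ x∈A _ → x∈A }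
    addPick-draw {V} {A} (just a) a∈V = record
      { pool-shrinks     = p─q⊆p V ⁅ a ⁆
      ; grows            = p⊆p∪q ⁅ a ⁆
      ; gains-from-pool  = λ x∈A∪a → Sum.map₂ (λ x≡a → subst (_∈ V) (sym x≡a) (a∈V a refl)) (split x∈A∪a)
      ; gains-leave-pool = λ x∈A∪a x∈V-a → [ id , (λ { refl → ⊥-elim (x∉p-x V a x∈V-a) }) ]′ (split x∈A∪a)
      }
      where
        split : ∀ {x} → x ∈ A ∪ ⁅ a ⁆ → x ∈ A ⊎ x ≡ a
        split = Sum.map₂ (x∈⁅y⁆⇒x≡y a) ∘ x∈p∪q⁻ A ⁅ a ⁆

    draw : ∀ i j o V A →
           Draw V A (proj₁ (addPick (sel i j o V A) V A)) (proj₂ (addPick (sel i j o V A) V A))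
    draw i j o V A = addPick-draw (sel i j o V A) (picks i j o V A)

    passL-pool-shrinks : ∀ {r} i j o V (As : Vec (Subset N) r) → proj₁ (passL i j o V As) ⊆ V
    passL-pool-shrinks i j o V []       = id
    passL-pool-shrinks i j o V (A ∷ As) = pool-shrinks ∘ passL-pool-shrinks i j (suc o) _ As
      where open Draw (draw i j o V A)

    passL-∪⋃ : ∀ {r} G i j o V (As : Vec (Subset N) r) {x} →
               x ∈ G ∪⋃ proj₂ (passL i j o V As) → x ∈ G ∪⋃ As ⊎ x ∈ V
    passL-∪⋃ G i j o V []       = inj₁
    passL-∪⋃ G i j o V (A ∷ As) =
      [ Sum.map₁ (p⊆p∪q _) ∘ gains-from-pool
      , Sum.map (q⊆p∪q A _) pool-shrinks ∘ passL-∪⋃ G i j (suc o) _ As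
      ]′ ∘ x∈p∪q⁻ _ _
      where open Draw (draw i j o V A)

    passL-preserves : ∀ {r} G i j o V (As : Vec (Subset N) r) → SunflowerOffPool G V As →
                      SunflowerOffPool G (proj₁ (passL i j o V As)) (proj₂ (passL i j o V As))
    passL-preserves G i j o V []       invariant = invariant
    passL-preserves G i j o V (A ∷ As) (petal G⊆A A∩U⊆G flower , U∩V⊆G) =
      petal (grows ∘ G⊆A) (meet⊆G new-petal-meets) flower′ , meet⊆G new-family-meets-pool
      where
        open Draw (draw i j o V A)
        V₁ = proj₁ (addPick (sel i j o V A) V A)
        A′ = proj₂ (addPick (sel i j o V A) V A)
        V′ = proj₁ (passL i j (suc o) V₁ As)
        As′ = proj₂ (passL i j (suc o) V₁ As)

        meet⊆G : ∀ {X Y} → (∀ {x} → x ∈ X → x ∈ Y → x ∈ G) → X ∩ Y ⊆ G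
        meet⊆G both = λ x∈X∩Y → let (x∈X , x∈Y) = x∈p∩q⁻ _ _ x∈X∩Y in both x∈X x∈Y

        old-meets-pool : ∀ {x} → x ∈ A ∪ (G ∪⋃ As) → x ∈ V → x ∈ G
        old-meets-pool x∈U x∈V = U∩V⊆G (x∈p∩q⁺ (x∈U , x∈V))

        rest = passL-preserves G i j (suc o) V₁ As
                 (flower , meet⊆G (λ x∈U x∈V₁ → old-meets-pool (q⊆p∪q A _ x∈U) (pool-shrinks x∈V₁)))
        flower′ = proj₁ rest

        gain-meets-pool : ∀ {x} → x ∈ A′ → x ∈ V₁ → x ∈ G
        gain-meets-pool x∈A′ x∈V₁ = old-meets-pool (p⊆p∪q _ (gains-leave-pool x∈A′ x∈V₁)) (pool-shrinks x∈V₁)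

        new-petal-meets : ∀ {x} → x ∈ A′ → x ∈ G ∪⋃ As′ → x ∈ G
        new-petal-meets x∈A′ x∈U′ with passL-∪⋃ G i j (suc o) V₁ As x∈U′
        ... | inj₂ x∈V₁ = gain-meets-pool x∈A′ x∈V₁
        ... | inj₁ x∈U with gains-from-pool x∈A′
        ...   | inj₁ x∈A = A∩U⊆G (x∈p∩q⁺ (x∈A , x∈U))
        ...   | inj₂ x∈V = old-meets-pool (q⊆p∪q A _ x∈U) x∈V

        new-family-meets-pool : ∀ {x} → x ∈ A′ ∪ (G ∪⋃ As′) → x ∈ V′ → x ∈ G
        new-family-meets-pool x∈A′∪U′ x∈V′ with x∈p∪q⁻ A′ _ x∈A′∪U′
        ... | inj₁ x∈A′ = gain-meets-pool x∈A′ (passL-pool-shrinks i j (suc o) V₁ As x∈V′)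
        ... | inj₂ x∈U′ = proj₂ rest (x∈p∩q⁺ (x∈U′ , x∈V′))

    loopJ-preserves : ∀ G i j r V (As : Vec (Subset N) (suc p)) → SunflowerOffPool G V As →
                      SunflowerOffPool G (proj₁ (loopJ i j r V As)) (proj₂ (loopJ i j r V As))
    loopJ-preserves G i j zero    V As invariant = invariant
    loopJ-preserves G i j (suc r) V As invariant =
      loopJ-preserves G i (suc j) r _ _ (passL-preserves G i j 1 V As invariant)

    petals : ℕ → Subset N → Subset N → Vec (Subset N) (suc p)
    petals i G V = proj₂ (loopJ i 1 m V (replicate (suc p) G))

    petals-sunflower : ∀ i G V → Sunflower G (petals i G V)
    petals-sunflower i G V =
      proj₁ (loopJ-preserves G i 1 m V (replicate (suc p) G) (replicate-sunflower (suc p) G , pool-meets))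
      where
        pool-meets : (G ∪⋃ replicate (suc p) G) ∩ V ⊆ G
        pool-meets = subst (λ U → U ∩ V ⊆ G) (sym (∪⋃-replicate (suc p) G)) (p∩q⊆p G V)

    expect-one-round : ∀ g i G V → expect g 1 i (G , V) ≡ ι *F sumV (map g (petals i G V))
    expect-one-round g i G V = cong (λ xs → ι *F sumV xs) (begin
      map (expect g 0 (suc i)) (tabulate (λ l → lookup As l , W))   ≡⟨ cong (map _) (tabulate-∘ (_, W) (lookup As)) ⟩
      map (expect g 0 (suc i)) (map (_, W) (tabulate (lookup As)))  ≡⟨ cong (map _ ∘ map _) (tabulate∘lookup As) ⟩
      map (expect g 0 (suc i)) (map (_, W) As)                      ≡⟨ map-∘ _ _ As ⟨
      map g As                                                      ∎)
      where
        open ≡-Reasoning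
        W = proj₁ (loopJ i 1 m V (replicate (suc p) G))
        As = petals i G V

    round-contracts : ∀ {g} → Nonnegative F g → Submodular F g →
                      ∀ i s → (1F -F ι) *F expect g 0 i s ≤F expect g 1 i s
    round-contracts {g} g-nonneg g-submodular i (G , V) = begin
      (1F -F ι) *F g G                  ≡⟨ [1-ι]x≡ι[px] (g G) ⟩
      ι *F (fromℕ p *F g G)             ≤⟨ *-monoʳ-≤ 0≤ι (sunflower-sum-bound g-nonneg (petals-sunflower i G V)) ⟩
      ι *F sumV (map g (petals i G V))  ≡⟨ expect-one-round g i G V ⟨
      expect g 1 i (G , V)              ∎
      where
        open ≤-Reasoning poset
        open SunflowerBound F g-submodular

lemmaE2 : ∀ {c ℓ'} (F : OrderedField c ℓ') → let open OrderedField F in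
    (n : ℕ) (f : Subset n → Carrier) → Nonnegative F f → Submodular F f →
    (k ℓ : ℕ) .{{_ : NonZero ℓ}} → 1 ≤ k →
    (O : Subset n) →
    (sel : Algorithm.Selector F f k ℓ) → Algorithm.IsArgmaxSelector F f k ℓ sel →
    (i : ℕ) → 1 ≤ i → i ≤ ℓ →
    (1F -F (fromℕ ℓ ⁻¹)) *F Algorithm.Run.E-fOG F f k ℓ sel O (i ∸ 1)
    ≤F Algorithm.Run.E-fOG F f k ℓ sel O i
lemmaE2 F n f f-nonneg f-submodular k zero {{()}} _ O sel isArgmax i _ _
lemmaE2 F n f f-nonneg f-submodular k (suc p) _ O sel isArgmax (suc d) _ _ =
  expect-contracts sel (round-contracts (argmax⇒picksFromPool isArgmax) g-nonneg g-submodular) d 1 initial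
  where
    open GreedyRounds F f k p
    open Algorithm F f k (suc p)
    open Run sel using (initial)
    open SubmodularClosure F

    g-nonneg : Nonnegative F (λ G → fExt (lift O ∪ G))
    g-nonneg G = f-nonneg _

    g-submodular : Submodular F (λ G → fExt (lift O ∪ G))
    g-submodular = Submodular-∘-∪ˡ (Submodular-∘-take f-submodular) (lift O)
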